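{- Let $I_1=(V_1,d_1,s)$ be a $(u,v)$-spanned instance and $I_2=(V_2,d_2,s)$ a $(w,z)$-spanned instance of Channel Assignment (same $s$). Then there is an instance $I=(V_1\cup V_2,d,s)$ of Channel Assignment which is $(x,y)$-spanned for every $x\in\{u,w\}$ and every $y\in\{v,z\}$, and such that: (i) for every YES-coloring $c$ of $I$, the restriction $c|_{V_1}$ is a YES-coloring of $I_1$ and $c|_{V_2}$ is a YES-coloring of $I_2$; (ii) for every YES-coloring $c_1$ of $I_1$ and every YES-coloring $c_2$ of $I_2$ with $c_1(u)=c_2(w)$, $c_1(v)=c_2(z)$, and $c_1(x)=c_2(x)$ for all $x\in V_1\cap V_2$, there is a YES-coloring $c$ of $I$ with $c|_{V_1}=c_1$ and $c|_{V_2}=c_2$.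
   Context: An instance of Channel Assignment is a triple $(V,d,s)$ where $V$ is a finite set, $d:V\times V\to\mathbb{N}$ is symmetric (minimum allowed distances, $\mathbb{N}\ni 0$) and $s\in\mathbb{N}$. A coloring $c:V\to\mathbb{Z}$ is proper if $|c(x)-c(y)|\ge d(x,y)$ for all distinct $x,y\in V$; its span is $\max_{v}c(v)-\min_v c(v)+1$. A YES-coloring is a proper coloring of span at most $s$; the instance is a yes-instance iff it has a YES-coloring. The instance is $(x,y)$-spanned for $x,y\in V$ if every YES-coloring $c$ satisfies $|c(x)-c(y)|=s-1$. -}

module Defs where

open import Data.Nat using (ℕ; _≤_; _<_; _∸_)
open import Data.Integer using (ℤ; ∣_∣; _-_)
open import Data.List using (List)
open import Data.List.Membership.Propositional using (_∈_)
open import Data.Product using (_×_)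
open import Relation.Binary.PropositionalEquality using (_≡_; _≢_)

-- An instance (V, d, s) of Channel Assignment over an ambient type A:
-- V : List A (a finite set; duplicates are harmless), d : A → A → ℕ
-- (only its values on V matter), s : ℕ.  Colorings are functions A → ℤ
-- (only their values on V matter; "restriction to V" is just reading c on V).

SymmetricDist : {A : Set} → (A → A → ℕ) → Set
SymmetricDist d = ∀ x y → d x y ≡ d y x

Proper : {A : Set} → List A → (A → A → ℕ) → (A → ℤ) → Set
Proper V d c = ∀ {x y} → x ∈ V → y ∈ V → x ≢ y → d x y ≤ ∣ c x - c y ∣

-- span (max c - min c + 1 over V) is at most s, i.e. max - min < s,
-- i.e. |c(x) - c(y)| < s for all x, y ∈ V
SpanAtMost : {A : Set} → List A → (A → ℤ) → ℕ → Set
SpanAtMost V c s = ∀ {x y} → x ∈ V → y ∈ V → ∣ c x - c y ∣ < s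

YES : {A : Set} → List A → (A → A → ℕ) → ℕ → (A → ℤ) → Set
YES V d s c = Proper V d c × SpanAtMost V c s

Spanned : {A : Set} → List A → (A → A → ℕ) → ℕ → A → A → Set
Spanned V d s x y = ∀ (c : _ → ℤ) → YES V d s c → ∣ c x - c y ∣ ≡ s ∸ 1

-- The glued instance keeps d₁ on V₁ and d₂ on V₂ and demands distance s − 1 between every
-- anchor in {u, w} and every anchor in {v, z}.  Since it dominates d₁ and d₂, its YES-colorings
-- restrict to YES-colorings, and each anchor pair is at distance ≥ s − 1 by the demand and
-- < s by the span bound.  Conversely, gluing c₁ and c₂ that agree on the anchors gives a
-- proper coloring in which every color lies within s − 1 of both c₁ u and c₁ v, which are
-- s − 1 apart; on a line such colors lie in the segment between them, so the span stays
-- below s.  If {u, w} and {v, z} share a vertex, it gets both anchor colors, forcing s ≤ 1;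
-- the anchor demand is then doubled so that the glued instance forces s ≤ 1 as well.
module Submission where

open import Defs
open import Data.Nat using (ℕ)
open import Data.Integer using (ℤ)
open import Data.List using (List; _++_; _∷_; [])
open import Data.List.Membership.Propositional using (_∈_)
open import Data.Product using (Σ; _×_)
open import Relation.Binary.Definitions using (DecidableEquality)
open import Relation.Binary.PropositionalEquality using (_≡_)

open import Data.Nat using (zero; suc; _+_; _≤_; _<_; _∸_; _⊔_; z≤n; s≤s)
open import Data.Nat.Properties
  using ( ≤-reflexive; ≤-trans; ≤-antisym; ≤-<-trans; <⇒≱; ≤-<-connex; n≤0⇒n≡0; n<1+n
        ; +-comm; +-identityʳ; +-mono-≤; +-mono-<; +-monoʳ-≤; +-cancelˡ-≤; m≤m+n
        ; m≤m⊔n; m≤n⊔m; ⊔-lub; +-commutativeSemigroup; module ≤-Reasoning )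
open import Data.Integer using (∣_∣; _-_)
import Data.Integer as ℤ
import Data.Integer.Properties as ℤₚ
open import Algebra.Properties.CommutativeSemigroup +-commutativeSemigroup using (interchange)
open import Data.Empty using (⊥-elim)
open import Data.Sum using (_⊎_; inj₁; inj₂)
import Data.Sum as Sum
open import Data.Product using (_,_; proj₁; proj₂)
import Data.Product as Product
open import Data.List.Relation.Unary.Any using (Any; here; there; any?)
open import Data.List.Membership.Propositional using (find; lose)
open import Data.List.Membership.Propositional.Properties using (∈-++⁻)
open import Data.List.Relation.Binary.Subset.Propositional using (_⊆_)
open import Data.List.Relation.Binary.Subset.Propositional.Properties using (xs⊆xs++ys; xs⊆ys++xs)
import Data.List.Membership.DecPropositional as DecMembership
open import Relation.Nullary using (Dec; yes; no; _×-dec_; _⊎-dec_)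
open import Relation.Binary.PropositionalEquality
  using (_≢_; refl; sym; trans; cong; cong₂; subst; module ≡-Reasoning)

m+n≤m⇒n≡0 : ∀ m {n} → m + n ≤ m → n ≡ 0
m+n≤m⇒n≡0 m {n} le = n≤0⇒n≡0 (+-cancelˡ-≤ m n 0 (≤-trans le (≤-reflexive (sym (+-identityʳ m)))))

m+m≤n+n⇒m≤n : ∀ {m n} → m + m ≤ n + n → m ≤ n
m+m≤n+n⇒m≤n {m} {n} le with ≤-<-connex m n
... | inj₁ m≤n = m≤n
... | inj₂ n<m = ⊥-elim (<⇒≱ (+-mono-< n<m n<m) le)

<⇒≤∸1 : ∀ {m n} → m < n → m ≤ n ∸ 1
<⇒≤∸1 (s≤s m≤n) = m≤n

<⇒∸1< : ∀ {m n} → m < n → n ∸ 1 < n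
<⇒∸1< {n = suc n} _ = n<1+n n

≤∸1∧<⇒≡∸1 : ∀ {m n} → n ∸ 1 ≤ m → m < n → m ≡ n ∸ 1
≤∸1∧<⇒≡∸1 n∸1≤m m<n = ≤-antisym (<⇒≤∸1 m<n) n∸1≤m

[n∸1]+[n∸1]<n⇒n∸1≡0 : ∀ n → (n ∸ 1) + (n ∸ 1) < n → n ∸ 1 ≡ 0
[n∸1]+[n∸1]<n⇒n∸1≡0 zero    _                = refl
[n∸1]+[n∸1]<n⇒n∸1≡0 (suc n) (s≤s n+n≤n) = m+n≤m⇒n≡0 n n+n≤n

dist : ℤ → ℤ → ℕ
dist p q = ∣ p - q ∣

dist-sym : ∀ p q → dist p q ≡ dist q p
dist-sym = ℤₚ.∣i-j∣≡∣j-i∣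

dist-self : ∀ p → dist p p ≡ 0
dist-self p = cong ∣_∣ (ℤₚ.+-inverseʳ p)

dist≡0⇒≡ : ∀ p q → dist p q ≡ 0 → p ≡ q
dist≡0⇒≡ p q eq = ℤₚ.i-j≡0⇒i≡j p q (ℤₚ.∣i∣≡0⇒i≡0 eq)

dist-triangle : ∀ p q r → dist p r ≤ dist p q + dist q r
dist-triangle p q r =
  subst (λ i → ∣ i ∣ ≤ dist p q + dist q r) (ℤₚ.+-minus-telescope p q r) (ℤₚ.∣i+j∣≤∣i∣+∣j∣ (p - q) (q - r))

Between : ℤ → ℤ → ℤ → Set
Between p q r = dist p r ≡ dist p q + dist q r

Between-sym : ∀ p q r → Between p q r → Between r q p
Between-sym p q r pqr = begin
  dist r p              ≡⟨ dist-sym r p ⟩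
  dist p r              ≡⟨ pqr ⟩
  dist p q + dist q r   ≡⟨ +-comm (dist p q) (dist q r) ⟩
  dist q r + dist p q   ≡⟨ cong₂ _+_ (dist-sym q r) (dist-sym p q) ⟩
  dist r q + dist q p   ∎
  where open ≡-Reasoning

Between-left : ∀ p q → Between p p q
Between-left p q = cong (_+ dist p q) (sym (dist-self p))

Between-right : ∀ p q → Between p q q
Between-right p q = sym (trans (cong (dist p q +_) (dist-self q)) (+-identityʳ (dist p q)))

≤⇒Between : ∀ {p q r} → p ℤ.≤ q → q ℤ.≤ r → Between p q r
≤⇒Between {p} {q} {r} p≤q q≤r = ℤₚ.+-injective (begin
  ℤ.+ dist p r                ≡⟨ ℤₚ.∣-∣-≤ (ℤₚ.≤-trans p≤q q≤r) ⟩
  r - p                       ≡⟨ ℤₚ.+-minus-telescope r q p ⟨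
  (r - q) ℤ.+ (q - p)         ≡⟨ ℤₚ.+-comm (r - q) (q - p) ⟩
  (q - p) ℤ.+ (r - q)         ≡⟨ cong₂ ℤ._+_ (ℤₚ.∣-∣-≤ p≤q) (ℤₚ.∣-∣-≤ q≤r) ⟨
  ℤ.+ dist p q ℤ.+ ℤ.+ dist q r   ∎)
  where open ≡-Reasoning

collinear : ∀ p q r → Between p q r ⊎ Between p r q ⊎ Between q p r
collinear p q r with ℤₚ.≤-total p q | ℤₚ.≤-total q r | ℤₚ.≤-total p r
... | inj₁ p≤q | inj₁ q≤r | _        = inj₁ (≤⇒Between p≤q q≤r)
... | inj₂ q≤p | inj₂ r≤q | _        = inj₁ (Between-sym r q p (≤⇒Between r≤q q≤p))
... | inj₁ p≤q | inj₂ r≤q | inj₁ p≤r = inj₂ (inj₁ (≤⇒Between p≤r r≤q))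
... | inj₂ q≤p | inj₁ q≤r | inj₂ r≤p = inj₂ (inj₁ (Between-sym q r p (≤⇒Between q≤r r≤p)))
... | inj₂ q≤p | inj₁ q≤r | inj₁ p≤r = inj₂ (inj₂ (≤⇒Between q≤p p≤r))
... | inj₁ p≤q | inj₂ r≤q | inj₂ r≤p = inj₂ (inj₂ (Between-sym r p q (≤⇒Between r≤p p≤q)))

near-ends⇒Between : ∀ a x b → dist a x ≤ dist a b → dist x b ≤ dist a b → Between a x b
near-ends⇒Between a x b ax≤ab xb≤ab with collinear a x b
... | inj₁ axb = axb
... | inj₂ (inj₁ abx) =
  subst (Between a x) (sym (dist≡0⇒≡ b x (m+n≤m⇒n≡0 (dist a b) (subst (_≤ dist a b) abx ax≤ab))))
        (Between-right a x)
... | inj₂ (inj₂ xab) =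
  subst (λ t → Between t x b) (dist≡0⇒≡ x a (m+n≤m⇒n≡0 (dist a b)
          (subst (_≤ dist a b) (trans xab (+-comm (dist x a) (dist a b))) xb≤ab)))
        (Between-left x b)

-- Both points lie on the segment from a to b, so twice their distance is at most twice its length.
near-ends⇒dist≤ : ∀ a b x y →
  dist a x ≤ dist a b → dist x b ≤ dist a b → dist a y ≤ dist a b → dist y b ≤ dist a b →
  dist x y ≤ dist a b
near-ends⇒dist≤ a b x y ax≤ab xb≤ab ay≤ab yb≤ab = m+m≤n+n⇒m≤n (begin
  dist x y + dist x y                             ≤⟨ +-mono-≤ (dist-triangle x a y) (dist-triangle x b y) ⟩
  (dist x a + dist a y) + (dist x b + dist b y)   ≡⟨ cong₂ (λ p q → (p + dist a y) + (dist x b + q))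
                                                           (dist-sym x a) (dist-sym b y) ⟩
  (dist a x + dist a y) + (dist x b + dist y b)   ≡⟨ interchange (dist a x) (dist a y) (dist x b) (dist y b) ⟩
  (dist a x + dist x b) + (dist a y + dist y b)   ≡⟨ cong₂ _+_ (near-ends⇒Between a x b ax≤ab xb≤ab)
                                                           (near-ends⇒Between a y b ay≤ab yb≤ab) ⟨
  dist a b + dist a b                             ∎)
  where open ≤-Reasoning

when : {P : Set} → Dec P → ℕ → ℕ
when (yes _) n = n
when (no _)  _ = 0

when-yes : ∀ {P : Set} (p? : Dec P) n → P → when p? n ≡ n
when-yes (yes _) n _ = refl
when-yes (no ¬p) n p = ⊥-elim (¬p p)

when-≤ : ∀ {P : Set} (p? : Dec P) {n m} → (P → n ≤ m) → when p? n ≤ m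
when-≤ (yes p) n≤m = n≤m p
when-≤ (no _)  _   = z≤n

when-cong : ∀ {P Q : Set} (p? : Dec P) (q? : Dec Q) {m n} → (P → Q) → (Q → P) → m ≡ n → when p? m ≡ when q? n
when-cong (yes _) (yes _) _   _   m≡n = m≡n
when-cong (yes p) (no ¬q) P→Q _   _   = ⊥-elim (¬q (P→Q p))
when-cong (no ¬p) (yes q) _   Q→P _   = ⊥-elim (¬p (Q→P q))
when-cong (no _)  (no _)  _   _   _   = refl

module _ {A : Set} {V : List A} where

  Proper-⊔ : ∀ {d d′ : A → A → ℕ} {c} → Proper V d c → Proper V d′ c → Proper V (λ x y → d x y ⊔ d′ x y) c
  Proper-⊔ proper proper′ x∈V y∈V x≢y = ⊔-lub (proper x∈V y∈V x≢y) (proper′ x∈V y∈V x≢y)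

  Proper-cong : ∀ {d c c′} → (∀ {x} → x ∈ V → c x ≡ c′ x) → Proper V d c → Proper V d c′
  Proper-cong {d} c≗c′ proper {x} {y} x∈V y∈V x≢y =
    subst (d x y ≤_) (cong₂ dist (c≗c′ x∈V) (c≗c′ y∈V)) (proper x∈V y∈V x≢y)

  YES-weaken : ∀ {W d d′ s c} → W ⊆ V → (∀ {x y} → x ∈ W → y ∈ W → d′ x y ≤ d x y) →
               YES V d s c → YES W d′ s c
  YES-weaken W⊆V d′≤d (proper , span) =
    (λ x∈W y∈W x≢y → ≤-trans (d′≤d x∈W y∈W) (proper (W⊆V x∈W) (W⊆V y∈W) x≢y)) ,
    (λ x∈W y∈W → span (W⊆V x∈W) (W⊆V y∈W))

  SpanAtMost-anchored : ∀ {c s} a b → dist a b ≡ s ∸ 1 →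
    (∀ {t} → t ∈ V → dist a (c t) < s × dist (c t) b < s) → SpanAtMost V c s
  SpanAtMost-anchored {c} {s} a b ab≡k near {x} {y} x∈V y∈V =
    ≤-<-trans (near-ends⇒dist≤ a b (c x) (c y) (bound (proj₁ (near x∈V))) (bound (proj₂ (near x∈V)))
                               (bound (proj₁ (near y∈V))) (bound (proj₂ (near y∈V))))
              (subst (_< s) (sym ab≡k) (<⇒∸1< (proj₁ (near x∈V))))
    where
    bound : ∀ {m} → m < s → m ≤ dist a b
    bound m<s = ≤-trans (<⇒≤∸1 m<s) (≤-reflexive (sym ab≡k))

module Supported {A : Set} (_≟_ : DecidableEquality A) where
  open DecMembership _≟_ using (_∈?_)

  Both : List A → A → A → Set
  Both V x y = x ∈ V × y ∈ V

  both? : ∀ V x y → Dec (Both V x y)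
  both? V x y = x ∈? V ×-dec y ∈? V

  Across : List A → List A → A → A → Set
  Across L R x y = (x ∈ L × y ∈ R) ⊎ (y ∈ L × x ∈ R)

  across? : ∀ L R x y → Dec (Across L R x y)
  across? L R x y = (x ∈? L ×-dec y ∈? R) ⊎-dec (y ∈? L ×-dec x ∈? R)

  restrict : List A → (A → A → ℕ) → A → A → ℕ
  restrict V d x y = when (both? V x y) (d x y)

  across : List A → List A → ℕ → A → A → ℕ
  across L R n x y = when (across? L R x y) n

  restrict-sym : ∀ V {d} → SymmetricDist d → SymmetricDist (restrict V d)
  restrict-sym V d-sym x y = when-cong (both? V x y) (both? V y x) Product.swap Product.swap (d-sym x y)

  across-sym : ∀ L R n → SymmetricDist (across L R n)
  across-sym L R n x y = when-cong (across? L R x y) (across? L R y x) Sum.swap Sum.swap refl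

  restrict-∈ : ∀ {V d x y} → x ∈ V → y ∈ V → restrict V d x y ≡ d x y
  restrict-∈ {V} {d} {x} {y} x∈V y∈V = when-yes (both? V x y) (d x y) (x∈V , y∈V)

  across-∈ : ∀ {L R n x y} → x ∈ L → y ∈ R → across L R n x y ≡ n
  across-∈ {L} {R} {n} {x} {y} x∈L y∈R = when-yes (across? L R x y) n (inj₁ (x∈L , y∈R))

  Proper-restrict : ∀ {V W d c} → Proper V d c → Proper W (restrict V d) c
  Proper-restrict {V} proper {x} {y} _ _ x≢y = when-≤ (both? V x y) (λ (x∈V , y∈V) → proper x∈V y∈V x≢y)

  Proper-across : ∀ {L R n W c} → (∀ {x y} → x ∈ L → y ∈ R → n ≤ dist (c x) (c y)) → Proper W (across L R n) c
  Proper-across {L} {R} {n} {c = c} n≤ {x} {y} _ _ _ = when-≤ (across? L R x y) λ where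
    (inj₁ (x∈L , y∈R)) → n≤ x∈L y∈R
    (inj₂ (y∈L , x∈R)) → subst (n ≤_) (dist-sym (c y) (c x)) (n≤ y∈L x∈R)

module Amalgamation {A : Set} (_≟_ : DecidableEquality A)
  (V₁ V₂ : List A) (d₁ d₂ : A → A → ℕ) (s : ℕ) (u v w z : A) where
  open Supported _≟_
  open DecMembership _≟_ using (_∈?_)

  k : ℕ
  k = s ∸ 1

  L R : List A
  L = u ∷ w ∷ []
  R = v ∷ z ∷ []

  Overlap : Set
  Overlap = Any (_∈ R) L

  overlap? : Dec Overlap
  overlap? = any? (_∈? R) L

  anchor : ℕ
  anchor = k + when overlap? k

  d : A → A → ℕ
  d x y = restrict V₁ d₁ x y ⊔ restrict V₂ d₂ x y ⊔ across L R anchor x y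

  d-sym : SymmetricDist d₁ → SymmetricDist d₂ → SymmetricDist d
  d-sym d₁-sym d₂-sym x y =
    cong₂ _⊔_ (cong₂ _⊔_ (restrict-sym V₁ d₁-sym x y) (restrict-sym V₂ d₂-sym x y)) (across-sym L R anchor x y)

  d₁≤d : ∀ {x y} → x ∈ V₁ → y ∈ V₁ → d₁ x y ≤ d x y
  d₁≤d {x} {y} x∈V₁ y∈V₁ = subst (_≤ d x y) (restrict-∈ {d = d₁} x∈V₁ y∈V₁)
    (≤-trans (m≤m⊔n (restrict V₁ d₁ x y) (restrict V₂ d₂ x y)) (m≤m⊔n _ (across L R anchor x y)))

  d₂≤d : ∀ {x y} → x ∈ V₂ → y ∈ V₂ → d₂ x y ≤ d x y
  d₂≤d {x} {y} x∈V₂ y∈V₂ = subst (_≤ d x y) (restrict-∈ {d = d₂} x∈V₂ y∈V₂)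
    (≤-trans (m≤n⊔m (restrict V₁ d₁ x y) (restrict V₂ d₂ x y)) (m≤m⊔n _ (across L R anchor x y)))

  anchor≤d : ∀ {x y} → x ∈ L → y ∈ R → anchor ≤ d x y
  anchor≤d {x} {y} x∈L y∈R = subst (_≤ d x y) (across-∈ {n = anchor} x∈L y∈R) (m≤n⊔m _ (across L R anchor x y))

  YES⇒YES₁ : ∀ c → YES (V₁ ++ V₂) d s c → YES V₁ d₁ s c
  YES⇒YES₁ c = YES-weaken {c = c} (xs⊆xs++ys V₁ V₂) d₁≤d

  YES⇒YES₂ : ∀ c → YES (V₁ ++ V₂) d s c → YES V₂ d₂ s c
  YES⇒YES₂ c = YES-weaken {c = c} (xs⊆ys++xs V₂ V₁) d₂≤d

  module _ (u∈V₁ : u ∈ V₁) (v∈V₁ : v ∈ V₁) (w∈V₂ : w ∈ V₂) (z∈V₂ : z ∈ V₂)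
           (spanned₁ : Spanned V₁ d₁ s u v) where

    L⊆V : L ⊆ V₁ ++ V₂
    L⊆V (here refl)         = xs⊆xs++ys V₁ V₂ u∈V₁
    L⊆V (there (here refl)) = xs⊆ys++xs V₂ V₁ w∈V₂

    R⊆V : R ⊆ V₁ ++ V₂
    R⊆V (here refl)         = xs⊆xs++ys V₁ V₂ v∈V₁
    R⊆V (there (here refl)) = xs⊆ys++xs V₂ V₁ z∈V₂

    anchor≤dist : ∀ c {x y} → YES (V₁ ++ V₂) d s c → x ∈ L → y ∈ R → x ≢ y → anchor ≤ dist (c x) (c y)
    anchor≤dist c (proper , _) x∈L y∈R x≢y = ≤-trans (anchor≤d x∈L y∈R) (proper (L⊆V x∈L) (R⊆V y∈R) x≢y)

    overlap⇒k≡0 : ∀ c → YES (V₁ ++ V₂) d s c → Overlap → k ≡ 0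
    overlap⇒k≡0 c yes-c common = by-cases (u ≟ v)
      where
      open ≤-Reasoning
      by-cases : Dec (u ≡ v) → k ≡ 0
      by-cases (yes refl) = trans (sym (spanned₁ c (YES⇒YES₁ c yes-c))) (dist-self (c u))
      by-cases (no u≢v)   = [n∸1]+[n∸1]<n⇒n∸1≡0 s (begin-strict
        k + k             ≡⟨ cong (k +_) (when-yes overlap? k common) ⟨
        anchor            ≤⟨ anchor≤dist c yes-c (here refl) (here refl) u≢v ⟩
        dist (c u) (c v)  <⟨ proj₂ yes-c (L⊆V (here refl)) (R⊆V (here refl)) ⟩
        s                 ∎)

    spanned : ∀ x y → x ∈ L → y ∈ R → Spanned (V₁ ++ V₂) d s x y
    spanned x y x∈L y∈R c yes-c with x ≟ y
    ... | yes refl = trans (dist-self (c x)) (sym (overlap⇒k≡0 c yes-c (lose x∈L y∈R)))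
    ... | no x≢y   = ≤∸1∧<⇒≡∸1 (≤-trans (m≤m+n k (when overlap? k)) (anchor≤dist c yes-c x∈L y∈R x≢y))
                               (proj₂ yes-c (L⊆V x∈L) (R⊆V y∈R))

    module Glue (c₁ c₂ : A → ℤ) (yes₁ : YES V₁ d₁ s c₁) (yes₂ : YES V₂ d₂ s c₂)
                (u≈w : c₁ u ≡ c₂ w) (v≈z : c₁ v ≡ c₂ z) (agree : ∀ x → x ∈ V₁ → x ∈ V₂ → c₁ x ≡ c₂ x) where

      c : A → ℤ
      c x with x ∈? V₁
      ... | yes _ = c₁ x
      ... | no _  = c₂ x

      c≗c₁ : ∀ x → x ∈ V₁ → c x ≡ c₁ x
      c≗c₁ x x∈V₁ with x ∈? V₁
      ... | yes _    = refl
      ... | no x∉V₁  = ⊥-elim (x∉V₁ x∈V₁)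

      c≗c₂ : ∀ x → x ∈ V₂ → c x ≡ c₂ x
      c≗c₂ x x∈V₂ with x ∈? V₁
      ... | yes x∈V₁ = agree x x∈V₁ x∈V₂
      ... | no _     = refl

      c-on-L : ∀ {x} → x ∈ L → c x ≡ c₁ u
      c-on-L (here refl)         = c≗c₁ u u∈V₁
      c-on-L (there (here refl)) = trans (c≗c₂ w w∈V₂) (sym u≈w)

      c-on-R : ∀ {x} → x ∈ R → c x ≡ c₁ v
      c-on-R (here refl)         = c≗c₁ v v∈V₁
      c-on-R (there (here refl)) = trans (c≗c₂ z z∈V₂) (sym v≈z)

      anchors-apart : dist (c₁ u) (c₁ v) ≡ k
      anchors-apart = spanned₁ c₁ yes₁

      anchor≤k : anchor ≤ k
      anchor≤k = subst (anchor ≤_) (+-identityʳ k) (+-monoʳ-≤ k (when-≤ overlap? λ common →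
        let (x , x∈L , x∈R) = find common in
        ≤-reflexive (trans (sym anchors-apart)
                           (trans (cong₂ dist (sym (c-on-L x∈L)) (sym (c-on-R x∈R))) (dist-self (c x))))))

      proper₁ : Proper V₁ d₁ c
      proper₁ = Proper-cong (λ {x} x∈V₁ → sym (c≗c₁ x x∈V₁)) (proj₁ yes₁)

      proper₂ : Proper V₂ d₂ c
      proper₂ = Proper-cong (λ {x} x∈V₂ → sym (c≗c₂ x x∈V₂)) (proj₁ yes₂)

      proper-anchors : Proper (V₁ ++ V₂) (across L R anchor) c
      proper-anchors = Proper-across {c = c} λ x∈L y∈R → ≤-trans anchor≤k (≤-reflexive (trans (sym anchors-apart)
                                                          (cong₂ dist (sym (c-on-L x∈L)) (sym (c-on-R y∈R)))))

      proper : Proper (V₁ ++ V₂) d c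
      proper = Proper-⊔ {c = c} (Proper-⊔ {c = c} (Proper-restrict {c = c} proper₁) (Proper-restrict {c = c} proper₂))
                        proper-anchors

      near-anchors : ∀ {t} → t ∈ V₁ ++ V₂ → dist (c₁ u) (c t) < s × dist (c t) (c₁ v) < s
      near-anchors {t} t∈V with ∈-++⁻ V₁ t∈V
      ... | inj₁ t∈V₁ rewrite c≗c₁ t t∈V₁ = proj₂ yes₁ u∈V₁ t∈V₁ , proj₂ yes₁ t∈V₁ v∈V₁
      ... | inj₂ t∈V₂ rewrite c≗c₂ t t∈V₂ | u≈w | v≈z = proj₂ yes₂ w∈V₂ t∈V₂ , proj₂ yes₂ t∈V₂ z∈V₂

      span : SpanAtMost (V₁ ++ V₂) c s
      span = SpanAtMost-anchored (c₁ u) (c₁ v) anchors-apart near-anchors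

lemma5 : {A : Set} → DecidableEquality A →
  (V₁ V₂ : List A) (d₁ d₂ : A → A → ℕ) (s : ℕ) (u v w z : A) →
  SymmetricDist d₁ → SymmetricDist d₂ →
  u ∈ V₁ → v ∈ V₁ → w ∈ V₂ → z ∈ V₂ →
  Spanned V₁ d₁ s u v → Spanned V₂ d₂ s w z →
  Σ (A → A → ℕ) λ d →
    SymmetricDist d
    × (∀ x y → x ∈ u ∷ w ∷ [] → y ∈ v ∷ z ∷ [] → Spanned (V₁ ++ V₂) d s x y)
    × (∀ (c : A → ℤ) → YES (V₁ ++ V₂) d s c → YES V₁ d₁ s c × YES V₂ d₂ s c)
    × (∀ (c₁ c₂ : A → ℤ) → YES V₁ d₁ s c₁ → YES V₂ d₂ s c₂ →
         c₁ u ≡ c₂ w → c₁ v ≡ c₂ z →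
         (∀ x → x ∈ V₁ → x ∈ V₂ → c₁ x ≡ c₂ x) →
         Σ (A → ℤ) λ c → YES (V₁ ++ V₂) d s c
           × (∀ x → x ∈ V₁ → c x ≡ c₁ x)
           × (∀ x → x ∈ V₂ → c x ≡ c₂ x))
lemma5 _≟_ V₁ V₂ d₁ d₂ s u v w z d₁-sym d₂-sym u∈V₁ v∈V₁ w∈V₂ z∈V₂ spanned₁ _ =
  d , d-sym d₁-sym d₂-sym , spanned u∈V₁ v∈V₁ w∈V₂ z∈V₂ spanned₁ ,
  (λ c yes-c → YES⇒YES₁ c yes-c , YES⇒YES₂ c yes-c) ,
  λ c₁ c₂ yes₁ yes₂ u≈w v≈z agree →
    let open Glue u∈V₁ v∈V₁ w∈V₂ z∈V₂ spanned₁ c₁ c₂ yes₁ yes₂ u≈w v≈z agree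
    in c , (proper , span) , c≗c₁ , c≗c₂
  where open Amalgamation _≟_ V₁ V₂ d₁ d₂ s u v w z
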